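{- For every integer $n\ge 0$, there is a one-to-one correspondence between the set of bicolored plane trees with $n$ edges and the set of free Dyck paths of length $2n$.
   Context: A plane tree is a rooted tree in which the children of each vertex are linearly ordered. A bicolored plane tree is a plane tree in which each child of the root is colored with one of two colors (black or white); no other vertices are colored. A free Dyck path of length $2n$ is a lattice path from $(0,0)$ to $(2n,0)$ consisting of $n$ up steps $(1,1)$ and $n$ down steps $(1,-1)$, with no further restriction. -}

module Defs where

open import Data.Nat using (ℕ; zero; suc; _+_)
open import Data.Bool using (Bool)
open import Data.List using (List; []; _∷_)
open import Data.Product using (Σ; _×_; _,_)
open import Relation.Binary.PropositionalEquality using (_≡_)

data PlaneTree : Set where
  node : List PlaneTree → PlaneTree

mutual
  edges : PlaneTree → ℕ
  edges (node ts) = forestEdges ts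

  forestEdges : List PlaneTree → ℕ
  forestEdges []       = zero
  forestEdges (t ∷ ts) = suc (edges t) + forestEdges ts

-- Colors: Bool (true = black, false = white).
Color : Set
Color = Bool

-- Bicolored plane tree: a plane tree whose root's children (each the root of
-- a subtree) carry one of two colors; represented as the ordered list of
-- (color of child, subtree rooted at that child).
BicoloredPlaneTree : Set
BicoloredPlaneTree = List (Color × PlaneTree)

bEdges : BicoloredPlaneTree → ℕ
bEdges []             = zero
bEdges ((c , t) ∷ ts) = suc (edges t) + bEdges ts

BPT : ℕ → Set
BPT n = Σ BicoloredPlaneTree (λ b → bEdges b ≡ n)

data Step : Set where
  up   : Step
  down : Step

ups : List Step → ℕ
ups []          = zero
ups (up ∷ s)    = suc (ups s)
ups (down ∷ s)  = ups s

downs : List Step → ℕ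
downs []         = zero
downs (up ∷ s)   = downs s
downs (down ∷ s) = suc (downs s)

FreeDyck : ℕ → Set
FreeDyck n = Σ (List Step) (λ p → ups p ≡ n × downs p ≡ n)

-- Reading a word from right to left and cancelling every factor ↑ w ↓ with w a Dyck word
-- factors each word uniquely as F₀ ↓ D₁ ↓ ⋯ ↓ Dₐ ↑ U₁ ↑ ⋯ ↑ U_b with all Fᵢ, Dᵢ, Uᵢ Dyck
-- words, i.e. plane forests; edges are counted by ups inside these forests, so the word has
-- as many ups as downs exactly when a = b. Cutting a bicolored plane tree just before each
-- white subtree gives a black forest F₀ followed by pairs (white subtree with children Dᵢ,
-- black forest Uᵢ): the same data with a = b, the edge from the root to a white child being
-- paid for by one ↓ and one ↑.
module Submission where

open import Defs
open import Data.Bool using (true; false)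
open import Data.List using (List; []; _∷_; _++_; foldr; map; length)
open import Data.List.Properties using (++-assoc; ++-identityʳ)
open import Data.Nat using (ℕ; suc; _+_)
open import Data.Nat.ListAction using (sum)
open import Data.Nat.Properties using (+-suc; +-cancelˡ-≡; suc-injective; ≡-irrelevant)
open import Data.Nat.Tactic.RingSolver using (solve-∀)
open import Data.Product using (Σ; _×_; _,_; proj₁)
open import Function.Base using (_∘_)
open import Function.Bundles using (_⤖_; mk↔ₛ′)
open import Function.Properties.Inverse using (↔⇒⤖)
open import Relation.Nullary.Irrelevant using (Irrelevant)
open import Relation.Binary.PropositionalEquality
  using (_≡_; refl; sym; trans; cong; cong₂; module ≡-Reasoning)

dyck : List PlaneTree → List Step
dyck []             = []
dyck (node cs ∷ ts) = up ∷ dyck cs ++ down ∷ dyck ts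

record Reduced : Set where
  constructor ⟨_,_,_⟩
  field
    prefix : List PlaneTree
    falls  : List (List PlaneTree)
    rises  : List (List PlaneTree)

open Reduced

steps : Step → List (List PlaneTree) → List Step
steps s []       = []
steps s (F ∷ Fs) = s ∷ dyck F ++ steps s Fs

word : Reduced → List Step
word ⟨ F , Ds , Us ⟩ = dyck F ++ steps down Ds ++ steps up Us

cons : Step → Reduced → Reduced
cons down ⟨ F , Ds     , Us ⟩ = ⟨ [] , F ∷ Ds , Us ⟩
cons up   ⟨ F , D ∷ Ds , Us ⟩ = ⟨ node F ∷ D , Ds , Us ⟩
cons up   ⟨ F , []     , Us ⟩ = ⟨ [] , [] , F ∷ Us ⟩

reduce : List Step → Reduced
reduce = foldr cons ⟨ [] , [] , [] ⟩

prepend : List PlaneTree → Reduced → Reduced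
prepend F r = record r { prefix = F ++ prefix r }

word-cons : ∀ s r → word (cons s r) ≡ s ∷ word r
word-cons down ⟨ F , Ds , Us ⟩ = cong (down ∷_) (++-assoc (dyck F) (steps down Ds) (steps up Us))
word-cons up ⟨ F , D ∷ Ds , Us ⟩ = cong (up ∷_) (begin
  (dyck F ++ down ∷ dyck D) ++ steps down Ds ++ steps up Us
    ≡⟨ ++-assoc (dyck F) (down ∷ dyck D) _ ⟩
  dyck F ++ down ∷ dyck D ++ steps down Ds ++ steps up Us
    ≡⟨ cong (λ w → dyck F ++ down ∷ w) (++-assoc (dyck D) (steps down Ds) (steps up Us)) ⟨
  dyck F ++ (down ∷ dyck D ++ steps down Ds) ++ steps up Us ∎)
  where open ≡-Reasoning
word-cons up ⟨ F , [] , Us ⟩ = refl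

word-reduce : ∀ w → word (reduce w) ≡ w
word-reduce []      = refl
word-reduce (s ∷ w) = trans (word-cons s (reduce w)) (cong (s ∷_) (word-reduce w))

reduce-dyck-++ : ∀ F w → reduce (dyck F ++ w) ≡ prepend F (reduce w)
reduce-dyck-++ [] w = refl
reduce-dyck-++ (node cs ∷ ts) w = begin
  cons up (reduce ((dyck cs ++ down ∷ dyck ts) ++ w))
    ≡⟨ cong (cons up ∘ reduce) (++-assoc (dyck cs) (down ∷ dyck ts) w) ⟩
  cons up (reduce (dyck cs ++ down ∷ dyck ts ++ w))
    ≡⟨ cong (cons up) (reduce-dyck-++ cs (down ∷ dyck ts ++ w)) ⟩
  cons up (prepend cs (cons down (reduce (dyck ts ++ w))))
    ≡⟨ cong (cons up ∘ prepend cs ∘ cons down) (reduce-dyck-++ ts w) ⟩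
  cons up (prepend cs (cons down (prepend ts (reduce w))))
    ≡⟨ cong (λ F → record (reduce w) { prefix = node F ∷ ts ++ prefix (reduce w) }) (++-identityʳ cs) ⟩
  prepend (node cs ∷ ts) (reduce w) ∎
  where open ≡-Reasoning

reduce-rises : ∀ Us → reduce (steps up Us) ≡ ⟨ [] , [] , Us ⟩
reduce-rises []       = refl
reduce-rises (U ∷ Us) = begin
  cons up (reduce (dyck U ++ steps up Us))  ≡⟨ cong (cons up) (reduce-dyck-++ U (steps up Us)) ⟩
  cons up (prepend U (reduce (steps up Us))) ≡⟨ cong (cons up ∘ prepend U) (reduce-rises Us) ⟩
  ⟨ [] , [] , (U ++ []) ∷ Us ⟩              ≡⟨ cong (λ F → ⟨ [] , [] , F ∷ Us ⟩) (++-identityʳ U) ⟩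
  ⟨ [] , [] , U ∷ Us ⟩                      ∎
  where open ≡-Reasoning

reduce-falls-rises : ∀ Ds Us → reduce (steps down Ds ++ steps up Us) ≡ ⟨ [] , Ds , Us ⟩
reduce-falls-rises []       Us = reduce-rises Us
reduce-falls-rises (D ∷ Ds) Us = begin
  cons down (reduce ((dyck D ++ steps down Ds) ++ steps up Us))
    ≡⟨ cong (cons down ∘ reduce) (++-assoc (dyck D) (steps down Ds) (steps up Us)) ⟩
  cons down (reduce (dyck D ++ steps down Ds ++ steps up Us))
    ≡⟨ cong (cons down) (reduce-dyck-++ D _) ⟩
  cons down (prepend D (reduce (steps down Ds ++ steps up Us)))
    ≡⟨ cong (cons down ∘ prepend D) (reduce-falls-rises Ds Us) ⟩
  ⟨ [] , (D ++ []) ∷ Ds , Us ⟩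
    ≡⟨ cong (λ F → ⟨ [] , F ∷ Ds , Us ⟩) (++-identityʳ D) ⟩
  ⟨ [] , D ∷ Ds , Us ⟩ ∎
  where open ≡-Reasoning

reduce-word : ∀ r → reduce (word r) ≡ r
reduce-word ⟨ F , Ds , Us ⟩ = begin
  reduce (dyck F ++ steps down Ds ++ steps up Us) ≡⟨ reduce-dyck-++ F _ ⟩
  prepend F (reduce (steps down Ds ++ steps up Us)) ≡⟨ cong (prepend F) (reduce-falls-rises Ds Us) ⟩
  ⟨ F ++ [] , Ds , Us ⟩                             ≡⟨ cong ⟨_, Ds , Us ⟩ (++-identityʳ F) ⟩
  ⟨ F , Ds , Us ⟩                                   ∎
  where open ≡-Reasoning

forestsEdges : List (List PlaneTree) → ℕ
forestsEdges Fs = sum (map forestEdges Fs)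

size : Reduced → ℕ
size ⟨ F , Ds , Us ⟩ = forestEdges F + forestsEdges Ds + forestsEdges Us

ups-reduce : ∀ w → ups w ≡ size (reduce w) + length (rises (reduce w))
ups-reduce []         = refl
ups-reduce (up ∷ w)   = trans (cong suc (ups-reduce w)) (cons-up (reduce w))
  where
  cons-up : ∀ r → suc (size r + length (rises r)) ≡ size (cons up r) + length (rises (cons up r))
  cons-up ⟨ F , D ∷ Ds , Us ⟩ = shuffle (forestEdges F) (forestEdges D) (forestsEdges Ds) (forestsEdges Us) (length Us)
    where
    shuffle : ∀ a b c d k → suc (a + (b + c) + d + k) ≡ suc (a + b) + c + d + k
    shuffle = solve-∀
  cons-up ⟨ F , [] , Us ⟩ = shuffle (forestEdges F) (forestsEdges Us) (length Us)
    where
    shuffle : ∀ a d k → suc (a + 0 + d + k) ≡ a + d + suc k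
    shuffle = solve-∀
ups-reduce (down ∷ w) = ups-reduce w

downs-reduce : ∀ w → downs w ≡ size (reduce w) + length (falls (reduce w))
downs-reduce []         = refl
downs-reduce (up ∷ w)   = trans (downs-reduce w) (cons-up (reduce w))
  where
  cons-up : ∀ r → size r + length (falls r) ≡ size (cons up r) + length (falls (cons up r))
  cons-up ⟨ F , D ∷ Ds , Us ⟩ = shuffle (forestEdges F) (forestEdges D) (forestsEdges Ds) (forestsEdges Us) (length Ds)
    where
    shuffle : ∀ a b c d k → a + (b + c) + d + suc k ≡ suc (a + b) + c + d + k
    shuffle = solve-∀
  cons-up ⟨ F , [] , Us ⟩ = shuffle (forestEdges F) (forestsEdges Us)
    where
    shuffle : ∀ a d → a + 0 + d + 0 ≡ a + d + 0
    shuffle = solve-∀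
downs-reduce (down ∷ w) = trans (cong suc (downs-reduce w)) (sym (+-suc _ _))

ups-word : ∀ r → ups (word r) ≡ size r + length (rises r)
ups-word r = trans (ups-reduce (word r)) (cong (λ r′ → size r′ + length (rises r′)) (reduce-word r))

downs-word : ∀ r → downs (word r) ≡ size r + length (falls r)
downs-word r = trans (downs-reduce (word r)) (cong (λ r′ → size r′ + length (falls r′)) (reduce-word r))

reduce-balanced : ∀ w → ups w ≡ downs w → length (falls (reduce w)) ≡ length (rises (reduce w))
reduce-balanced w eq =
  +-cancelˡ-≡ (size (reduce w)) _ _ (trans (sym (downs-reduce w)) (trans (sym eq) (ups-reduce w)))

push : Color × PlaneTree → Reduced → Reduced
push (true  , t)       r               = record r { prefix = t ∷ prefix r }
push (false , node cs) ⟨ F , Ds , Us ⟩ = ⟨ [] , cs ∷ Ds , F ∷ Us ⟩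

toReduced : BicoloredPlaneTree → Reduced
toReduced = foldr push ⟨ [] , [] , [] ⟩

black : List PlaneTree → BicoloredPlaneTree
black = map (true ,_)

whiteRuns : List (List PlaneTree) → List (List PlaneTree) → BicoloredPlaneTree
whiteRuns (D ∷ Ds) (U ∷ Us) = (false , node D) ∷ black U ++ whiteRuns Ds Us
whiteRuns _        _        = []  -- unmatched falls or rises are dropped

fromReduced : Reduced → BicoloredPlaneTree
fromReduced ⟨ F , Ds , Us ⟩ = black F ++ whiteRuns Ds Us

fromReduced-toReduced : ∀ B → fromReduced (toReduced B) ≡ B
fromReduced-toReduced []                      = refl
fromReduced-toReduced ((true  , t)       ∷ B) = cong ((true , t) ∷_) (fromReduced-toReduced B)
fromReduced-toReduced ((false , node cs) ∷ B) = cong ((false , node cs) ∷_) (fromReduced-toReduced B)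

toReduced-black-++ : ∀ F B → toReduced (black F ++ B) ≡ prepend F (toReduced B)
toReduced-black-++ []      B = refl
toReduced-black-++ (t ∷ F) B = cong (push (true , t)) (toReduced-black-++ F B)

toReduced-whiteRuns : ∀ Ds Us → length Ds ≡ length Us → toReduced (whiteRuns Ds Us) ≡ ⟨ [] , Ds , Us ⟩
toReduced-whiteRuns []       []       _  = refl
toReduced-whiteRuns (D ∷ Ds) (U ∷ Us) eq = begin
  push (false , node D) (toReduced (black U ++ whiteRuns Ds Us))
    ≡⟨ cong (push (false , node D)) (toReduced-black-++ U (whiteRuns Ds Us)) ⟩
  push (false , node D) (prepend U (toReduced (whiteRuns Ds Us)))
    ≡⟨ cong (push (false , node D) ∘ prepend U) (toReduced-whiteRuns Ds Us (suc-injective eq)) ⟩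
  ⟨ [] , D ∷ Ds , (U ++ []) ∷ Us ⟩
    ≡⟨ cong (λ F → ⟨ [] , D ∷ Ds , F ∷ Us ⟩) (++-identityʳ U) ⟩
  ⟨ [] , D ∷ Ds , U ∷ Us ⟩ ∎
  where open ≡-Reasoning

toReduced-fromReduced : ∀ r → length (falls r) ≡ length (rises r) → toReduced (fromReduced r) ≡ r
toReduced-fromReduced ⟨ F , Ds , Us ⟩ eq = begin
  toReduced (black F ++ whiteRuns Ds Us)    ≡⟨ toReduced-black-++ F (whiteRuns Ds Us) ⟩
  prepend F (toReduced (whiteRuns Ds Us))   ≡⟨ cong (prepend F) (toReduced-whiteRuns Ds Us eq) ⟩
  ⟨ F ++ [] , Ds , Us ⟩                     ≡⟨ cong ⟨_, Ds , Us ⟩ (++-identityʳ F) ⟩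
  ⟨ F , Ds , Us ⟩                           ∎
  where open ≡-Reasoning

toReduced-balanced : ∀ B → length (falls (toReduced B)) ≡ length (rises (toReduced B))
toReduced-balanced []                      = refl
toReduced-balanced ((true  , t)       ∷ B) = toReduced-balanced B
toReduced-balanced ((false , node cs) ∷ B) = cong suc (toReduced-balanced B)

bEdges-toReduced : ∀ B → bEdges B ≡ size (toReduced B) + length (falls (toReduced B))
bEdges-toReduced [] = refl
bEdges-toReduced ((true , t) ∷ B) =
  trans (cong (suc (edges t) +_) (bEdges-toReduced B))
        (shuffle (edges t) (forestEdges F) (forestsEdges Ds) (forestsEdges Us) (length Ds))
  where
  open Reduced (toReduced B) renaming (prefix to F; falls to Ds; rises to Us)
  shuffle : ∀ e a c d k → suc e + (a + c + d + k) ≡ suc e + a + c + d + k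
  shuffle = solve-∀
bEdges-toReduced ((false , node cs) ∷ B) =
  trans (cong (suc (forestEdges cs) +_) (bEdges-toReduced B))
        (shuffle (forestEdges cs) (forestEdges F) (forestsEdges Ds) (forestsEdges Us) (length Ds))
  where
  open Reduced (toReduced B) renaming (prefix to F; falls to Ds; rises to Us)
  shuffle : ∀ g a c d k → suc g + (a + c + d + k) ≡ g + c + (a + d) + suc k
  shuffle = solve-∀

encode : BicoloredPlaneTree → List Step
encode = word ∘ toReduced

decode : List Step → BicoloredPlaneTree
decode = fromReduced ∘ reduce

decode-encode : ∀ B → decode (encode B) ≡ B
decode-encode B = trans (cong fromReduced (reduce-word (toReduced B))) (fromReduced-toReduced B)

encode-decode : ∀ w → ups w ≡ downs w → encode (decode w) ≡ w
encode-decode w eq =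
  trans (cong word (toReduced-fromReduced (reduce w) (reduce-balanced w eq))) (word-reduce w)

ups-encode : ∀ B → ups (encode B) ≡ bEdges B
ups-encode B = begin
  ups (word (toReduced B))                                  ≡⟨ ups-word (toReduced B) ⟩
  size (toReduced B) + length (rises (toReduced B))         ≡⟨ cong (size (toReduced B) +_) (toReduced-balanced B) ⟨
  size (toReduced B) + length (falls (toReduced B))         ≡⟨ bEdges-toReduced B ⟨
  bEdges B                                                  ∎
  where open ≡-Reasoning

downs-encode : ∀ B → downs (encode B) ≡ bEdges B
downs-encode B = trans (downs-word (toReduced B)) (sym (bEdges-toReduced B))

bEdges-decode : ∀ w → ups w ≡ downs w → bEdges (decode w) ≡ downs w
bEdges-decode w eq = trans (sym (downs-encode (decode w))) (cong downs (encode-decode w eq))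

Σ-≡-from-proj₁ : {A : Set} {P : A → Set} → (∀ {a} → Irrelevant (P a)) →
                 {x y : Σ A P} → proj₁ x ≡ proj₁ y → x ≡ y
Σ-≡-from-proj₁ irrelevant {a , p} {.a , q} refl = cong (a ,_) (irrelevant p q)

theorem2p2 : (n : ℕ) → BPT n ⤖ FreeDyck n
theorem2p2 n = ↔⇒⤖ (mk↔ₛ′ to from to-from from-to)
  where
  to : BPT n → FreeDyck n
  to (B , e) = encode B , trans (ups-encode B) e , trans (downs-encode B) e

  from : FreeDyck n → BPT n
  from (w , u , d) = decode w , trans (bEdges-decode w (trans u (sym d))) d

  to-from : ∀ p → to (from p) ≡ p
  to-from (w , u , d) =
    Σ-≡-from-proj₁ (λ (u₁ , d₁) (u₂ , d₂) → cong₂ _,_ (≡-irrelevant u₁ u₂) (≡-irrelevant d₁ d₂))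
                   (encode-decode w (trans u (sym d)))

  from-to : ∀ b → from (to b) ≡ b
  from-to (B , e) = Σ-≡-from-proj₁ ≡-irrelevant (decode-encode B)
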